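{- There exist stable matching instances $A$ and $B$ on the same workers and firms that are $(0,n)$ (every worker has the same preference list in $A$ and $B$) such that $\mathcal{M}_A\setminus\mathcal{M}_B$ is not a semi-sublattice of $\mathcal{L}_A$, i.e. it is neither closed under the join $\vee_A$ nor under the meet $\wedge_A$.
   Context: In a stable matching instance each agent strictly totally orders the agents of the other side; a perfect matching $M$ is stable under $I$ if no pair $(w,f)\notin M$ has $w$ preferring $f$ to $M(w)$ and $f$ preferring $w$ to $M(f)$ under $I$; $\mathcal{M}_I$ is the set of stable matchings of $I$; $\mathcal{L}_I$ is its lattice, where $M\vee_I M'$ assigns each worker its less preferred (under $I$) partner among $M(w),M'(w)$, and $M\wedge_I M'$ the more preferred one. A subset is a join (resp. meet) semi-sublattice of $\mathcal{L}_I$ if it is closed under $\vee_I$ (resp. $\wedge_I$). -}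

module Defs where

open import Data.Nat using (ℕ)
open import Data.Fin using (Fin; _<_; _≤?_)
open import Data.Product using (_×_)
open import Function.Definitions using (Injective)
open import Relation.Binary.PropositionalEquality using (_≡_)
open import Relation.Nullary using (¬_; yes; no)

-- A strict total order on the other side is encoded by a rank function
-- (rank 0 = most preferred) that is injective, i.e. a bijection Fin n → Fin n.
record Instance (n : ℕ) : Set where
  field
    wrank    : Fin n → Fin n → Fin n   -- wrank w f = position of firm f in worker w's list
    wrank-inj : ∀ w → Injective _≡_ _≡_ (wrank w)
    frank    : Fin n → Fin n → Fin n   -- frank f w = position of worker w in firm f's list
    frank-inj : ∀ f → Injective _≡_ _≡_ (frank f)
open Instance public

WPrefers : ∀ {n} → Instance n → Fin n → Fin n → Fin n → Set
WPrefers I w f f' = wrank I w f < wrank I w f'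

FPrefers : ∀ {n} → Instance n → Fin n → Fin n → Fin n → Set
FPrefers I f w w' = frank I f w < frank I f w'

-- A candidate matching assigns a firm to each worker; it is a perfect
-- matching iff this assignment is injective (hence bijective on Fin n).
Assignment : ℕ → Set
Assignment n = Fin n → Fin n

PerfectMatching : ∀ {n} → Assignment n → Set
PerfectMatching M = Injective _≡_ _≡_ M

-- (w , f) blocks M under I: w prefers f to M(w) and f prefers w to M(f)
-- (M(f) being the worker w' with M w' ≡ f). Such a pair is automatically not in M.
Blocking : ∀ {n} → Instance n → Assignment n → Fin n → Fin n → Set
Blocking I M w f = WPrefers I w f (M w) × (∀ w' → M w' ≡ f → FPrefers I f w w')

Stable : ∀ {n} → Instance n → Assignment n → Set
Stable I M = PerfectMatching M × (∀ w f → ¬ Blocking I M w f)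

join : ∀ {n} → Instance n → Assignment n → Assignment n → Assignment n
join I M M' w with wrank I w (M w) ≤? wrank I w (M' w)
... | yes _ = M' w
... | no  _ = M w

meet : ∀ {n} → Instance n → Assignment n → Assignment n → Assignment n
meet I M M' w with wrank I w (M w) ≤? wrank I w (M' w)
... | yes _ = M w
... | no  _ = M' w

Diff : ∀ {n} → Instance n → Instance n → Assignment n → Set
Diff A B M = Stable A M × ¬ Stable B M

JoinClosed : ∀ {n} → Instance n → (Assignment n → Set) → Set
JoinClosed I S = ∀ M M' → S M → S M' → S (join I M M')

MeetClosed : ∀ {n} → Instance n → (Assignment n → Set) → Set
MeetClosed I S = ∀ M M' → S M → S M' → S (meet I M M')

SameWorkerPrefs : ∀ {n} → Instance n → Instance n → Set
SameWorkerPrefs A B = ∀ w f → wrank A w f ≡ wrank B w f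

-- Both instances share the workers' lists;
-- M₁ and M₂ are stable under A but not under B, while M₁ ∨_A M₂ and M₁ ∧_A M₂
-- are both stable under B, so each leaves 𝓜_A ∖ 𝓜_B.  On Fin n injectivity,
-- blocking and stability are decidable, and every stability claim about the
-- example is discharged by evaluating the decision procedure.
module Submission where

open import Defs
open import Data.Nat using (ℕ)
open import Data.Fin using (Fin; #_)
open import Data.Fin.Properties using (all?; _<?_; _≟_)
open import Data.Product using (_×_; ∃; ∃₂; _,_; proj₂)
open import Data.Vec using (Vec; _∷_; []; lookup)
open import Function.Definitions using (Injective)
open import Relation.Binary.PropositionalEquality using (_≡_; refl)
open import Relation.Nullary using (¬_; Dec)
open import Relation.Nullary.Decidable
  using (_×-dec_; _→-dec_; ¬?; map′; toWitness; toWitnessFalse; True; False)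

module _ {n : ℕ} where

  injective? : (g : Fin n → Fin n) → Dec (Injective _≡_ _≡_ g)
  injective? g =
    map′ (λ inj {x} {y} → inj x y) (λ inj x y → inj {x} {y})
         (all? λ x → all? λ y → (g x ≟ g y) →-dec (x ≟ y))

  blocking? : (I : Instance n) (M : Assignment n) (w f : Fin n) →
              Dec (Blocking I M w f)
  blocking? I M w f =
    (wrank I w f <? wrank I w (M w)) ×-dec
    all? (λ w′ → (M w′ ≟ f) →-dec (frank I f w <? frank I f w′))

  stable? : (I : Instance n) (M : Assignment n) → Dec (Stable I M)
  stable? I M =
    injective? M ×-dec all? (λ w → all? λ f → ¬? (blocking? I M w f))

  RankTable : Set
  RankTable = Vec (Vec (Fin n) n) n

  fromRankTables : (workers firms : RankTable) →
                   {_ : True (all? λ w → injective? (lookup (lookup workers w)))} →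
                   {_ : True (all? λ f → injective? (lookup (lookup firms f)))} →
                   Instance n
  fromRankTables workers firms {wok} {fok} = record
    { wrank     = λ w → lookup (lookup workers w)
    ; wrank-inj = toWitness wok
    ; frank     = λ f → lookup (lookup firms f)
    ; frank-inj = toWitness fok
    }

  Diff-notClosedUnder : {A B : Instance n} (_⊕_ : Assignment n → Assignment n → Assignment n)
                        {M M′ : Assignment n} → Diff A B M → Diff A B M′ → Stable B (M ⊕ M′) →
                        ¬ (∀ N N′ → Diff A B N → Diff A B N′ → Diff A B (N ⊕ N′))
  Diff-notClosedUnder _⊕_ {M} {M′} d d′ stableB closed = proj₂ (closed M M′ d d′) stableB

workerRanks : RankTable {4}
workerRanks = (# 3 ∷ # 2 ∷ # 0 ∷ # 1 ∷ [])
            ∷ (# 0 ∷ # 2 ∷ # 3 ∷ # 1 ∷ [])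
            ∷ (# 2 ∷ # 0 ∷ # 1 ∷ # 3 ∷ [])
            ∷ (# 1 ∷ # 2 ∷ # 0 ∷ # 3 ∷ [])
            ∷ []

A B : Instance 4
A = fromRankTables workerRanks
      ( (# 0 ∷ # 2 ∷ # 1 ∷ # 3 ∷ [])
      ∷ (# 3 ∷ # 0 ∷ # 2 ∷ # 1 ∷ [])
      ∷ (# 2 ∷ # 3 ∷ # 0 ∷ # 1 ∷ [])
      ∷ (# 2 ∷ # 1 ∷ # 0 ∷ # 3 ∷ [])
      ∷ [])
B = fromRankTables workerRanks
      ( (# 0 ∷ # 3 ∷ # 1 ∷ # 2 ∷ [])
      ∷ (# 1 ∷ # 3 ∷ # 2 ∷ # 0 ∷ [])
      ∷ (# 3 ∷ # 2 ∷ # 0 ∷ # 1 ∷ [])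
      ∷ (# 3 ∷ # 2 ∷ # 1 ∷ # 0 ∷ [])
      ∷ [])

M₁ M₂ : Assignment 4
M₁ = lookup (# 0 ∷ # 3 ∷ # 1 ∷ # 2 ∷ [])
M₂ = lookup (# 3 ∷ # 0 ∷ # 2 ∷ # 1 ∷ [])

stable-by-computation : (I : Instance 4) (M : Assignment 4) →
                        {_ : True (stable? I M)} → Stable I M
stable-by-computation I M {ok} = toWitness ok

unstable-by-computation : (I : Instance 4) (M : Assignment 4) →
                          {_ : False (stable? I M)} → ¬ Stable I M
unstable-by-computation I M {ko} = toWitnessFalse ko

M₁∈Diff : Diff A B M₁
M₁∈Diff = stable-by-computation A M₁ , unstable-by-computation B M₁

M₂∈Diff : Diff A B M₂
M₂∈Diff = stable-by-computation A M₂ , unstable-by-computation B M₂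

lemma5 : ∃ λ (n : ℕ) → ∃₂ λ (A B : Instance n) →
    SameWorkerPrefs A B × ¬ JoinClosed A (Diff A B) × ¬ MeetClosed A (Diff A B)
lemma5 = 4 , A , B , (λ _ _ → refl)
       , Diff-notClosedUnder {A = A} {B} (join A) M₁∈Diff M₂∈Diff (stable-by-computation B (join A M₁ M₂))
       , Diff-notClosedUnder {A = A} {B} (meet A) M₁∈Diff M₂∈Diff (stable-by-computation B (meet A M₁ M₂))
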